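{- Let $p$ be an odd prime and $m$ an integer with $1\le m\le p-2$. Let $V[x]$ be the $\mathbb{F}_p$-vector space of polynomials $f\in\mathbb{F}_p[x]$ of degree at most $p-2$ with $f(0)=0$, and let $A:V[x]\to V[x]$ be the linear map $A(f)(x)=f(x+1)-f(1)$. Then $\ker(A-I)^m$ is spanned by $x,x^2,\ldots,x^m$.
   Context: Polynomials in $V[x]$ are formal polynomials; $f(x+1)$ denotes formal substitution; $I$ is the identity map of $V[x]$. -}

module Defs where

open import Data.Nat as ℕ using (ℕ; zero; suc; _∸_; _<_)
open import Data.Integer as ℤ using (ℤ; 0ℤ; 1ℤ; +_; -_)
open import Data.Integer.Divisibility as ℤ∣ using ()
open import Data.List using (List; []; _∷_; [_]; replicate; _++_; map; foldr)
open import Data.Vec using (Vec; []; _∷_)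
open import Data.Product using (_×_; ∃)

-- F_p is represented as ℤ modulo p: a ≡ b in F_p  iff  p ∣ a - b.
_≡_[mod_] : ℤ → ℤ → ℕ → Set
a ≡ b [mod p ] = (+ p) ℤ∣.∣ (a ℤ.- b)

-- Formal polynomials: coefficient lists, lowest degree first.
Poly : Set
Poly = List ℤ

coeff : Poly → ℕ → ℤ
coeff []       _       = 0ℤ
coeff (a ∷ f)  zero    = a
coeff (a ∷ f)  (suc k) = coeff f k

_≈[_]_ : Poly → ℕ → Poly → Set
f ≈[ p ] g = ∀ k → coeff f k ≡ coeff g k [mod p ]

infixl 6 _+ₚ_
_+ₚ_ : Poly → Poly → Poly
[]      +ₚ g       = g
(a ∷ f) +ₚ []      = a ∷ f
(a ∷ f) +ₚ (b ∷ g) = (a ℤ.+ b) ∷ (f +ₚ g)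

scale : ℤ → Poly → Poly
scale c f = map (c ℤ.*_) f

negₚ : Poly → Poly
negₚ = scale (- 1ℤ)

mulX : Poly → Poly
mulX f = 0ℤ ∷ f

-- formal substitution f(x) ↦ f(x+1) (Horner: a + x·g ↦ a + (x+1)·g(x+1))
shift : Poly → Poly
shift []      = []
shift (a ∷ f) = [ a ] +ₚ (mulX (shift f) +ₚ shift f)

eval1 : Poly → ℤ
eval1 = foldr ℤ._+_ 0ℤ

A : Poly → Poly
A f = shift f +ₚ negₚ [ eval1 f ]

A-I : Poly → Poly
A-I f = A f +ₚ negₚ f

iter : ℕ → (Poly → Poly) → Poly → Poly
iter zero    T f = f
iter (suc n) T f = T (iter n T f)

InV : ℕ → Poly → Set
InV p f = (coeff f 0 ≡ 0ℤ [mod p ]) × (∀ k → p ∸ 2 < k → coeff f k ≡ 0ℤ [mod p ])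

monomial : ℕ → Poly
monomial k = replicate k 0ℤ ++ [ 1ℤ ]

lincombFrom : ∀ {m} → ℕ → Vec ℤ m → Poly
lincombFrom d []       = []
lincombFrom d (a ∷ as) = scale a (monomial d) +ₚ lincombFrom (suc d) as

InSpan : ℕ → ℕ → Poly → Set
InSpan p m f = ∃ λ (a : Vec ℤ m) → f ≈[ p ] lincombFrom 1 a

InKer : ℕ → ℕ → Poly → Set
InKer p m f = iter m A-I f ≈[ p ] []

-- Write T = A - I. On V[x], T lowers the degree by one: f(x+1) - f(x) has degree
-- deg f - 1, and the constant term f(1) - f(0) is cancelled by - f(1). Tracking the
-- top coefficient, if deg f ≤ j + n + 1 then the coefficient of x^(n+1) in Tʲ f is
-- (n+2)(n+3)⋯(n+j+1) · f_(j+n+1). So Tᵐ kills x, …, xᵐ; conversely, if Tᵐ f = 0 and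
-- deg f ≤ p - 2, descending induction on the degree kills every coefficient beyond xᵐ,
-- since all the factors above are nonzero modulo p.

module Submission where

open import Data.Integer as ℤ using (ℤ; 0ℤ; 1ℤ; +_; -_; _+_; _-_; _*_)
import Data.Integer.Divisibility.Signed as ℤ∣
import Data.Integer.Properties as ℤₚ
open import Data.Integer.Tactic.RingSolver using (solve-∀)
open import Data.List using ([]; _∷_; [_])
open import Data.Nat as ℕ using (ℕ; zero; suc; _≤_; _<_; _∸_; z≤n; s≤s)
open import Data.Nat.Divisibility using (_∣_; ∣1⇒≡1; ∣⇒≤)
open import Data.Nat.Primality using (Prime; euclidsLemma; prime⇒nonTrivial)
import Data.Nat.Properties as ℕₚ
open import Data.Product using (_×_; _,_; proj₂)
open import Data.Sum using (inj₁; inj₂)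
open import Data.Vec using (Vec; []; _∷_)
open import Function.Bundles using (_⇔_; mk⇔)
open import Level using (0ℓ)
open import Relation.Binary.Bundles using (Setoid)
open import Relation.Binary.PropositionalEquality
  using (_≡_; _≢_; refl; sym; trans; cong; cong₂; subst; module ≡-Reasoning)
import Relation.Binary.Reasoning.Setoid as SetoidReasoning
open import Relation.Nullary using (¬_; contradiction; yes; no)

open import Defs

coeff-+ₚ : ∀ f g k → coeff (f +ₚ g) k ≡ coeff f k + coeff g k
coeff-+ₚ []      g       k       = sym (ℤₚ.+-identityˡ _)
coeff-+ₚ (a ∷ f) []      k       = sym (ℤₚ.+-identityʳ _)
coeff-+ₚ (a ∷ f) (b ∷ g) zero    = refl
coeff-+ₚ (a ∷ f) (b ∷ g) (suc k) = coeff-+ₚ f g k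

coeff-scale : ∀ c f k → coeff (scale c f) k ≡ c * coeff f k
coeff-scale c []      k       = sym (ℤₚ.*-zeroʳ c)
coeff-scale c (a ∷ f) zero    = refl
coeff-scale c (a ∷ f) (suc k) = coeff-scale c f k

coeff-negₚ : ∀ f k → coeff (negₚ f) k ≡ - coeff f k
coeff-negₚ f k = trans (coeff-scale (- 1ℤ) f k) (ℤₚ.-1*i≡-i (coeff f k))

coeff-shift-∷-zero : ∀ a g → coeff (shift (a ∷ g)) 0 ≡ a + coeff (shift g) 0
coeff-shift-∷-zero a g = begin
  coeff ([ a ] +ₚ (mulX (shift g) +ₚ shift g)) 0  ≡⟨ coeff-+ₚ [ a ] (mulX (shift g) +ₚ shift g) 0 ⟩
  a + coeff (mulX (shift g) +ₚ shift g) 0         ≡⟨ cong (_+_ a) (coeff-+ₚ (mulX (shift g)) (shift g) 0) ⟩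
  a + (0ℤ + coeff (shift g) 0)                    ≡⟨ cong (_+_ a) (ℤₚ.+-identityˡ _) ⟩
  a + coeff (shift g) 0                           ∎
  where open ≡-Reasoning

coeff-shift-∷-suc : ∀ a g k →
  coeff (shift (a ∷ g)) (suc k) ≡ coeff (shift g) k + coeff (shift g) (suc k)
coeff-shift-∷-suc a g k = begin
  coeff ([ a ] +ₚ (mulX (shift g) +ₚ shift g)) (suc k)  ≡⟨ coeff-+ₚ [ a ] (mulX (shift g) +ₚ shift g) (suc k) ⟩
  0ℤ + coeff (mulX (shift g) +ₚ shift g) (suc k)        ≡⟨ ℤₚ.+-identityˡ _ ⟩
  coeff (mulX (shift g) +ₚ shift g) (suc k)             ≡⟨ coeff-+ₚ (mulX (shift g)) (shift g) (suc k) ⟩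
  coeff (shift g) k + coeff (shift g) (suc k)           ∎
  where open ≡-Reasoning

coeff-shift-zero : ∀ f → coeff (shift f) 0 ≡ eval1 f
coeff-shift-zero []      = refl
coeff-shift-zero (a ∷ g) = trans (coeff-shift-∷-zero a g) (cong (_+_ a) (coeff-shift-zero g))

coeff-A-I : ∀ f k →
  coeff (A-I f) k ≡ coeff (shift f) k - coeff [ eval1 f ] k - coeff f k
coeff-A-I f k = begin
  coeff (A f +ₚ negₚ f) k                                     ≡⟨ coeff-+ₚ (A f) (negₚ f) k ⟩
  coeff (A f) k + coeff (negₚ f) k                            ≡⟨ cong (_+_ (coeff (A f) k)) (coeff-negₚ f k) ⟩
  coeff (A f) k - coeff f k                                   ≡⟨ cong (_- coeff f k) (coeff-+ₚ (shift f) (negₚ [ eval1 f ]) k) ⟩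
  coeff (shift f) k + coeff (negₚ [ eval1 f ]) k - coeff f k  ≡⟨ cong (λ c → coeff (shift f) k + c - coeff f k)
                                                                      (coeff-negₚ [ eval1 f ] k) ⟩
  coeff (shift f) k - coeff [ eval1 f ] k - coeff f k         ∎
  where open ≡-Reasoning

coeff-A-I-zero : ∀ f → coeff (A-I f) 0 ≡ - coeff f 0
coeff-A-I-zero f = begin
  coeff (A-I f) 0                          ≡⟨ coeff-A-I f 0 ⟩
  coeff (shift f) 0 - eval1 f - coeff f 0  ≡⟨ cong (λ s → s - eval1 f - coeff f 0) (coeff-shift-zero f) ⟩
  eval1 f - eval1 f - coeff f 0            ≡⟨ cancel (eval1 f) (coeff f 0) ⟩
  - coeff f 0                              ∎
  where
  open ≡-Reasoning
  cancel : ∀ e c → e - e - c ≡ - c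
  cancel = solve-∀

coeff-A-I-suc : ∀ f k → coeff (A-I f) (suc k) ≡ coeff (shift f) (suc k) - coeff f (suc k)
coeff-A-I-suc f k =
  trans (coeff-A-I f (suc k)) (cong (_- coeff f (suc k)) (ℤₚ.+-identityʳ (coeff (shift f) (suc k))))

coeff-monomial-≢ : ∀ d {k} → d ≢ k → coeff (monomial d) k ≡ 0ℤ
coeff-monomial-≢ zero    {zero}  0≢0   = contradiction refl 0≢0
coeff-monomial-≢ zero    {suc k} _     = refl
coeff-monomial-≢ (suc d) {zero}  _     = refl
coeff-monomial-≢ (suc d) {suc k} d+1≢k+1 = coeff-monomial-≢ d (λ d≡k → d+1≢k+1 (cong suc d≡k))

coeff-monomial-self : ∀ d → coeff (monomial d) d ≡ 1ℤ
coeff-monomial-self zero    = refl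
coeff-monomial-self (suc d) = coeff-monomial-self d

module _ {m} (d : ℕ) (a : ℤ) (as : Vec ℤ m) where

  coeff-lincombFrom-∷ : ∀ k →
    coeff (lincombFrom d (a ∷ as)) k ≡ a * coeff (monomial d) k + coeff (lincombFrom (suc d) as) k
  coeff-lincombFrom-∷ k =
    trans (coeff-+ₚ (scale a (monomial d)) (lincombFrom (suc d) as) k)
          (cong (_+ coeff (lincombFrom (suc d) as) k) (coeff-scale a (monomial d) k))

  coeff-lincombFrom-∷-≢ : ∀ {k} → d ≢ k → coeff (lincombFrom d (a ∷ as)) k ≡ coeff (lincombFrom (suc d) as) k
  coeff-lincombFrom-∷-≢ {k} d≢k = begin
    coeff (lincombFrom d (a ∷ as)) k                             ≡⟨ coeff-lincombFrom-∷ k ⟩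
    a * coeff (monomial d) k + coeff (lincombFrom (suc d) as) k  ≡⟨ cong (λ c → a * c + coeff (lincombFrom (suc d) as) k)
                                                                         (coeff-monomial-≢ d d≢k) ⟩
    a * 0ℤ + coeff (lincombFrom (suc d) as) k                    ≡⟨ cong (_+ coeff (lincombFrom (suc d) as) k) (ℤₚ.*-zeroʳ a) ⟩
    0ℤ + coeff (lincombFrom (suc d) as) k                        ≡⟨ ℤₚ.+-identityˡ _ ⟩
    coeff (lincombFrom (suc d) as) k                             ∎
    where open ≡-Reasoning

coeff-lincombFrom-< : ∀ {m d k} (as : Vec ℤ m) → k < d → coeff (lincombFrom d as) k ≡ 0ℤ
coeff-lincombFrom-< []                   k<d = refl
coeff-lincombFrom-< {d = d} (a ∷ as) k<d =
  trans (coeff-lincombFrom-∷-≢ d a as (ℕₚ.>⇒≢ k<d)) (coeff-lincombFrom-< as (ℕₚ.m≤n⇒m≤1+n k<d))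

coeff-lincombFrom-≥ : ∀ {m d k} (as : Vec ℤ m) → d ℕ.+ m ≤ k → coeff (lincombFrom d as) k ≡ 0ℤ
coeff-lincombFrom-≥ []                              _        = refl
coeff-lincombFrom-≥ {suc m} {d} {k} (a ∷ as) d+m<k =
  trans (coeff-lincombFrom-∷-≢ d a as (ℕₚ.<⇒≢ d<k)) (coeff-lincombFrom-≥ as d+1+m≤k)
  where
  d+1+m≤k : suc d ℕ.+ m ≤ k
  d+1+m≤k = subst (_≤ k) (ℕₚ.+-suc d m) d+m<k
  d<k : d < k
  d<k = ℕₚ.≤-trans (s≤s (ℕₚ.m≤m+n d m)) d+1+m≤k

coeffsFrom : Poly → ℕ → (m : ℕ) → Vec ℤ m
coeffsFrom f d zero    = []
coeffsFrom f d (suc m) = coeff f d ∷ coeffsFrom f (suc d) m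

coeff-lincombFrom-coeffsFrom : ∀ f m {d k} → d ≤ k → k < d ℕ.+ m →
  coeff (lincombFrom d (coeffsFrom f d m)) k ≡ coeff f k
coeff-lincombFrom-coeffsFrom f zero {d} d≤k k<d+0 =
  contradiction d≤k (ℕₚ.<⇒≱ (subst (_ <_) (ℕₚ.+-identityʳ d) k<d+0))
coeff-lincombFrom-coeffsFrom f (suc m) {d} {k} d≤k k<d+m
  with ℕₚ.m≤n⇒m<n∨m≡n d≤k
... | inj₂ refl = begin
  coeff (lincombFrom d (coeffsFrom f d (suc m))) d                       ≡⟨ coeff-lincombFrom-∷ d (coeff f d) rest d ⟩
  coeff f d * coeff (monomial d) d + coeff (lincombFrom (suc d) rest) d  ≡⟨ cong₂ (λ c r → coeff f d * c + r)
                                                                                  (coeff-monomial-self d)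
                                                                                  (coeff-lincombFrom-< rest (ℕₚ.n<1+n d)) ⟩
  coeff f d * 1ℤ + 0ℤ                                                    ≡⟨ ℤₚ.+-identityʳ _ ⟩
  coeff f d * 1ℤ                                                         ≡⟨ ℤₚ.*-identityʳ _ ⟩
  coeff f d                                                              ∎
  where
  open ≡-Reasoning
  rest = coeffsFrom f (suc d) m
... | inj₁ d<k =
  trans (coeff-lincombFrom-∷-≢ d (coeff f d) (coeffsFrom f (suc d) m) (ℕₚ.<⇒≢ d<k))
        (coeff-lincombFrom-coeffsFrom f m d<k (subst (k <_) (ℕₚ.+-suc d m) k<d+m))

rising : ℕ → ℕ → ℕ
rising x zero    = 1
rising x (suc j) = x ℕ.* rising (suc x) j

prime∤rising : ∀ {p} → Prime p → ∀ j x → j ℕ.+ x < p → ¬ p ∣ rising (suc x) j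
prime∤rising pp zero    x _        p∣1 = ℕ.nonTrivial⇒≢1 {{prime⇒nonTrivial pp}} (∣1⇒≡1 p∣1)
prime∤rising {p} pp (suc j) x j+1+x<p p∣r with euclidsLemma (suc x) (rising (suc (suc x)) j) pp p∣r
... | inj₁ p∣x+1 = ℕₚ.<⇒≱ j+1+x<p (ℕₚ.≤-trans (∣⇒≤ p∣x+1) (s≤s (ℕₚ.m≤n+m x j)))
... | inj₂ p∣r′   = prime∤rising pp j (suc x) (subst (_< p) (sym (ℕₚ.+-suc j x)) j+1+x<p) p∣r′

module Modulo (p : ℕ) where

  -- A record rather than the bare  a ≡ b [mod p ] , which unfolds to a divisibility
  -- statement about ∣ a - b ∣ from which Agda cannot infer a and b.
  infix 4 _≋_
  record _≋_ (a b : ℤ) : Set where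
    constructor fromMod
    field toMod : a ≡ b [mod p ]
  open _≋_ public

  private
    toSigned : ∀ {a b} → a ≋ b → + p ℤ∣.∣ a - b
    toSigned a≋b = ℤ∣.∣ᵤ⇒∣ (toMod a≋b)

    fromSigned : ∀ {a b} → + p ℤ∣.∣ a - b → a ≋ b
    fromSigned {a} {b} p∣a-b = fromMod (ℤ∣.∣⇒∣ᵤ {+ p} {a - b} p∣a-b)

  ≋-reflexive : ∀ {a b} → a ≡ b → a ≋ b
  ≋-reflexive {a} refl = fromSigned (ℤ∣.divides 0ℤ (ℤₚ.+-inverseʳ a))

  ≋-refl : ∀ {a} → a ≋ a
  ≋-refl = ≋-reflexive refl

  ≋-sym : ∀ {a b} → a ≋ b → b ≋ a
  ≋-sym {a} {b} a≋b = fromSigned (subst (+ p ℤ∣.∣_) (flip a b) (ℤ∣.∣m⇒∣-m (toSigned a≋b)))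
    where
    flip : ∀ a b → - (a - b) ≡ b - a
    flip = solve-∀

  ≋-trans : ∀ {a b c} → a ≋ b → b ≋ c → a ≋ c
  ≋-trans {a} {b} {c} a≋b b≋c =
    fromSigned (subst (+ p ℤ∣.∣_) (telescope a b c) (ℤ∣.∣m∣n⇒∣m+n (toSigned a≋b) (toSigned b≋c)))
    where
    telescope : ∀ a b c → (a - b) + (b - c) ≡ a - c
    telescope = solve-∀

  ≋-setoid : Setoid 0ℓ 0ℓ
  ≋-setoid = record
    { Carrier       = ℤ
    ; _≈_           = _≋_
    ; isEquivalence = record { refl = ≋-refl ; sym = ≋-sym ; trans = ≋-trans }
    }

  +-cong : ∀ {a b c d} → a ≋ b → c ≋ d → a + c ≋ b + d
  +-cong {a} {b} {c} {d} a≋b c≋d =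
    fromSigned (subst (+ p ℤ∣.∣_) (regroup a b c d) (ℤ∣.∣m∣n⇒∣m+n (toSigned a≋b) (toSigned c≋d)))
    where
    regroup : ∀ a b c d → (a - b) + (c - d) ≡ (a + c) - (b + d)
    regroup = solve-∀

  neg-cong : ∀ {a b} → a ≋ b → - a ≋ - b
  neg-cong {a} {b} a≋b = fromSigned (subst (+ p ℤ∣.∣_) (regroup a b) (ℤ∣.∣m⇒∣-m (toSigned a≋b)))
    where
    regroup : ∀ a b → - (a - b) ≡ - a - - b
    regroup = solve-∀

  *-congˡ : ∀ c {a b} → a ≋ b → c * a ≋ c * b
  *-congˡ c {a} {b} a≋b = fromSigned (subst (+ p ℤ∣.∣_) (distrib c a b) (ℤ∣.∣n⇒∣m*n c (toSigned a≋b)))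
    where
    distrib : ∀ c a b → c * (a - b) ≡ c * a - c * b
    distrib = solve-∀

  module ≋-Reasoning = SetoidReasoning ≋-setoid

  record deg_<_ (f : Poly) (h : ℕ) : Set where
    constructor mkDeg<
    field coeff≋0 : ∀ k → h ≤ k → coeff f k ≋ 0ℤ
  open deg_<_ public

  deg<-mono : ∀ {f h h′} → h ≤ h′ → deg f < h → deg f < h′
  deg<-mono h≤h′ f<h = mkDeg< λ k h′≤k → coeff≋0 f<h k (ℕₚ.≤-trans h≤h′ h′≤k)

  deg<-tail : ∀ {a g h} → deg (a ∷ g) < suc h → deg g < h
  deg<-tail a∷g<h+1 = mkDeg< λ k h≤k → coeff≋0 a∷g<h+1 (suc k) (s≤s h≤k)

  deg<-pred : ∀ {f h} → deg f < suc h → coeff f h ≋ 0ℤ → deg f < h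
  deg<-pred {f} {h} f<h+1 fₕ≋0 = mkDeg< vanish
    where
    vanish : ∀ k → h ≤ k → coeff f k ≋ 0ℤ
    vanish k h≤k with ℕₚ.m≤n⇒m<n∨m≡n h≤k
    ... | inj₁ h<k  = coeff≋0 f<h+1 k h<k
    ... | inj₂ refl = fₕ≋0

  shift-deg< : ∀ {h} f → deg f < h → deg (shift f) < h
  coeff≋0 (shift-deg< []      _  ) _       _     = ≋-refl
  coeff≋0 (shift-deg< (a ∷ g) f<h) zero    h≤0   = begin
    coeff (shift (a ∷ g)) 0  ≡⟨ coeff-shift-∷-zero a g ⟩
    a + coeff (shift g) 0    ≈⟨ +-cong (coeff≋0 f<h 0 h≤0) (coeff≋0 (shift-deg< g g<0) 0 z≤n) ⟩
    0ℤ                       ∎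
    where
    open ≋-Reasoning
    g<0 : deg g < 0
    g<0 = deg<-tail (deg<-mono (ℕₚ.m≤n⇒m≤1+n h≤0) f<h)
  coeff≋0 (shift-deg< (a ∷ g) f<h) (suc k) h≤k+1 = begin
    coeff (shift (a ∷ g)) (suc k)                ≡⟨ coeff-shift-∷-suc a g k ⟩
    coeff (shift g) k + coeff (shift g) (suc k)  ≈⟨ +-cong (coeff≋0 (shift-deg< g g<k) k ℕₚ.≤-refl)
                                                           (coeff≋0 (shift-deg< g g<k) (suc k) (ℕₚ.n≤1+n k)) ⟩
    0ℤ                                           ∎
    where
    open ≋-Reasoning
    g<k : deg g < k
    g<k = deg<-tail (deg<-mono h≤k+1 f<h)

  shift-leading : ∀ {n} f → deg f < suc n → coeff (shift f) n ≋ coeff f n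
  shift-leading []              _     = ≋-refl
  shift-leading {zero} (a ∷ g) f<1 = begin
    coeff (shift (a ∷ g)) 0  ≡⟨ coeff-shift-∷-zero a g ⟩
    a + coeff (shift g) 0    ≈⟨ +-cong (≋-refl {a}) (coeff≋0 (shift-deg< g (deg<-tail f<1)) 0 z≤n) ⟩
    a + 0ℤ                   ≡⟨ ℤₚ.+-identityʳ a ⟩
    a                        ∎
    where open ≋-Reasoning
  shift-leading {suc n} (a ∷ g) f<n+2 = begin
    coeff (shift (a ∷ g)) (suc n)                ≡⟨ coeff-shift-∷-suc a g n ⟩
    coeff (shift g) n + coeff (shift g) (suc n)  ≈⟨ +-cong (shift-leading g g<n+1) (coeff≋0 (shift-deg< g g<n+1) (suc n) ℕₚ.≤-refl) ⟩
    coeff g n + 0ℤ                               ≡⟨ ℤₚ.+-identityʳ (coeff g n) ⟩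
    coeff g n                                    ∎
    where
    open ≋-Reasoning
    g<n+1 : deg g < suc n
    g<n+1 = deg<-tail f<n+2

  -- The binomial expansion of (x + 1)ⁿ⁺¹ contributes (n + 1) xⁿ.
  shift-subleading : ∀ {n} f → deg f < suc (suc n) →
    coeff (shift f) n ≋ coeff f n + + suc n * coeff f (suc n)
  shift-subleading {n} []   _ = ≋-reflexive (sym (trans (ℤₚ.+-identityˡ _) (ℤₚ.*-zeroʳ (+ suc n))))
  shift-subleading {zero} (a ∷ g) f<2 = begin
    coeff (shift (a ∷ g)) 0  ≡⟨ coeff-shift-∷-zero a g ⟩
    a + coeff (shift g) 0    ≈⟨ +-cong (≋-refl {a}) (shift-leading g (deg<-tail f<2)) ⟩
    a + coeff g 0            ≡⟨ cong (_+_ a) (sym (ℤₚ.*-identityˡ (coeff g 0))) ⟩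
    a + 1ℤ * coeff g 0       ∎
    where open ≋-Reasoning
  shift-subleading {suc n} (a ∷ g) f<n+3 = begin
    coeff (shift (a ∷ g)) (suc n)                            ≡⟨ coeff-shift-∷-suc a g n ⟩
    coeff (shift g) n + coeff (shift g) (suc n)              ≈⟨ +-cong (shift-subleading g g<n+2) (shift-leading g g<n+2) ⟩
    coeff g n + + suc n * coeff g (suc n) + coeff g (suc n)  ≡⟨ collect (coeff g n) (coeff g (suc n)) (+ suc n) ⟩
    coeff g n + (1ℤ + + suc n) * coeff g (suc n)             ∎
    where
    open ≋-Reasoning
    g<n+2 : deg g < suc (suc n)
    g<n+2 = deg<-tail f<n+3
    collect : ∀ x y c → x + c * y + y ≡ x + (1ℤ + c) * y
    collect = solve-∀

  V< : ℕ → Poly → Set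
  V< h f = coeff f 0 ≋ 0ℤ × deg f < h

  V<-mono : ∀ {h h′ f} → h ≤ h′ → V< h f → V< h′ f
  V<-mono h≤h′ (f₀≋0 , f<h) = f₀≋0 , deg<-mono h≤h′ f<h

  V<-cast : ∀ {h h′ f} → h ≡ h′ → V< h f → V< h′ f
  V<-cast refl Vf = Vf

  A-I-V< : ∀ {h} f → V< (suc h) f → V< h (A-I f)
  A-I-V< {h} f (f₀≋0 , f<h+1) = Tf₀≋0 , mkDeg< vanish
    where
    open ≋-Reasoning
    Tf₀≋0 : coeff (A-I f) 0 ≋ 0ℤ
    Tf₀≋0 = begin
      coeff (A-I f) 0  ≡⟨ coeff-A-I-zero f ⟩
      - coeff f 0      ≈⟨ neg-cong f₀≋0 ⟩
      0ℤ               ∎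
    vanish : ∀ k → h ≤ k → coeff (A-I f) k ≋ 0ℤ
    vanish zero    _     = Tf₀≋0
    vanish (suc k) h≤k+1 = begin
      coeff (A-I f) (suc k)                      ≡⟨ coeff-A-I-suc f k ⟩
      coeff (shift f) (suc k) - coeff f (suc k)  ≈⟨ +-cong (shift-leading f (deg<-mono (s≤s h≤k+1) f<h+1))
                                                           (≋-refl { - coeff f (suc k)}) ⟩
      coeff f (suc k) - coeff f (suc k)          ≡⟨ ℤₚ.+-inverseʳ (coeff f (suc k)) ⟩
      0ℤ                                         ∎

  A-I-leading : ∀ {n} f → deg f < suc (suc (suc n)) →
    coeff (A-I f) (suc n) ≋ + suc (suc n) * coeff f (suc (suc n))
  A-I-leading {n} f f<n+3 = begin
    coeff (A-I f) (suc n)                      ≡⟨ coeff-A-I-suc f n ⟩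
    coeff (shift f) (suc n) - coeff f (suc n)  ≈⟨ +-cong (shift-subleading f f<n+3) (≋-refl { - coeff f (suc n)}) ⟩
    coeff f (suc n) + top - coeff f (suc n)    ≡⟨ cancel (coeff f (suc n)) top ⟩
    top                                        ∎
    where
    open ≋-Reasoning
    top = + suc (suc n) * coeff f (suc (suc n))
    cancel : ∀ x y → x + y - x ≡ y
    cancel = solve-∀

  iter-A-I-V< : ∀ j {h} f → V< (j ℕ.+ h) f → V< h (iter j A-I f)
  iter-A-I-V< zero        f Vf = Vf
  iter-A-I-V< (suc j) {h} f Vf = A-I-V< (iter j A-I f) (iter-A-I-V< j f (V<-cast (sym (ℕₚ.+-suc j h)) Vf))

  iter-A-I-leading : ∀ j {n} f → V< (j ℕ.+ suc (suc n)) f →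
    coeff (iter j A-I f) (suc n) ≋ + rising (suc (suc n)) j * coeff f (j ℕ.+ suc n)
  iter-A-I-leading zero    {n} f _  = ≋-reflexive (sym (ℤₚ.*-identityˡ (coeff f (suc n))))
  iter-A-I-leading (suc j) {n} f Vf = begin
    coeff (A-I g) (suc n)                                               ≈⟨ A-I-leading g (proj₂ (iter-A-I-V< j f Vf′)) ⟩
    c * coeff g (suc (suc n))                                           ≈⟨ *-congˡ c (iter-A-I-leading j f Vf′) ⟩
    c * (+ rising (suc (suc (suc n))) j * coeff f (j ℕ.+ suc (suc n)))  ≡⟨ sym (ℤₚ.*-assoc c r (coeff f (j ℕ.+ suc (suc n)))) ⟩
    c * + rising (suc (suc (suc n))) j * coeff f (j ℕ.+ suc (suc n))    ≡⟨ cong₂ _*_ (sym (ℤₚ.pos-* (suc (suc n)) (rising (suc (suc (suc n))) j)))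
                                                                                     (cong (coeff f) (ℕₚ.+-suc j (suc n))) ⟩
    + rising (suc (suc n)) (suc j) * coeff f (suc j ℕ.+ suc n)          ∎
    where
    open ≋-Reasoning
    g = iter j A-I f
    c = + suc (suc n)
    r = + rising (suc (suc (suc n))) j
    Vf′ : V< (j ℕ.+ suc (suc (suc n))) f
    Vf′ = V<-cast (sym (ℕₚ.+-suc j (suc (suc n)))) Vf

  ≋0⇒∣∣ : ∀ {a} → a ≋ 0ℤ → p ∣ ℤ.∣ a ∣
  ≋0⇒∣∣ {a} a≋0 = subst (λ z → p ∣ ℤ.∣ z ∣) (ℤₚ.+-identityʳ a) (toMod a≋0)

  ∣∣⇒≋0 : ∀ {a} → p ∣ ℤ.∣ a ∣ → a ≋ 0ℤ
  ∣∣⇒≋0 {a} p∣a = fromMod (subst (λ z → p ∣ ℤ.∣ z ∣) (sym (ℤₚ.+-identityʳ a)) p∣a)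

  *-cancelˡ-≋0 : Prime p → ∀ {k x} → ¬ p ∣ k → + k * x ≋ 0ℤ → x ≋ 0ℤ
  *-cancelˡ-≋0 pp {k} {x} p∤k kx≋0
    with euclidsLemma k ℤ.∣ x ∣ pp (subst (p ∣_) (ℤₚ.abs-* (+ k) x) (≋0⇒∣∣ kx≋0))
  ... | inj₁ p∣k = contradiction p∣k p∤k
  ... | inj₂ p∣x = ∣∣⇒≋0 p∣x

  kernel-V< : Prime p → ∀ {m h f} → m ≤ h → h < p → deg (iter m A-I f) < 0 → V< (suc h) f → V< (suc m) f
  kernel-V< pp {m} {h} {f} m≤h h<p Tᵐf≋0 Vf =
    descend (h ∸ m) (subst (_< p) (sym (ℕₚ.m+[n∸m]≡n m≤h)) h<p)
                    (V<-cast (sym (trans (ℕₚ.+-suc m (h ∸ m)) (cong suc (ℕₚ.m+[n∸m]≡n m≤h)))) Vf)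
    where
    descend : ∀ t → m ℕ.+ t < p → V< (m ℕ.+ suc t) f → V< (suc m) f
    descend zero    _          Vf′             = V<-cast (ℕₚ.+-comm m 1) Vf′
    descend (suc t) m+t+1<p Vf′@(f₀≋0 , f<) =
      descend t (ℕₚ.<-trans (ℕₚ.+-monoʳ-< m (ℕₚ.n<1+n t)) m+t+1<p)
                (f₀≋0 , deg<-pred (deg<-mono (ℕₚ.≤-reflexive (ℕₚ.+-suc m (suc t))) f<) top≋0)
      where
      open ≋-Reasoning
      top≋0 : coeff f (m ℕ.+ suc t) ≋ 0ℤ
      top≋0 = *-cancelˡ-≋0 pp (prime∤rising pp m (suc t) m+t+1<p) (begin
        + rising (suc (suc t)) m * coeff f (m ℕ.+ suc t)  ≈⟨ ≋-sym (iter-A-I-leading m f Vf′) ⟩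
        coeff (iter m A-I f) (suc t)                      ≈⟨ coeff≋0 Tᵐf≋0 (suc t) z≤n ⟩
        0ℤ                                                ∎)

  V<-resp-≈ : ∀ {h f g} → f ≈[ p ] g → V< h g → V< h f
  V<-resp-≈ f≈g (g₀≋0 , g<h) =
    ≋-trans (fromMod (f≈g 0)) g₀≋0 , mkDeg< λ k h≤k → ≋-trans (fromMod (f≈g k)) (coeff≋0 g<h k h≤k)

  V<-lincombFrom : ∀ {m} (as : Vec ℤ m) → V< (suc m) (lincombFrom 1 as)
  V<-lincombFrom as =
    ≋-reflexive (coeff-lincombFrom-< as (s≤s z≤n)) , mkDeg< λ k m+1≤k → ≋-reflexive (coeff-lincombFrom-≥ as m+1≤k)

  V<⇒≈lincombFrom : ∀ {m f} → V< (suc m) f → f ≈[ p ] lincombFrom 1 (coeffsFrom f 1 m)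
  V<⇒≈lincombFrom {m} {f} (f₀≋0 , f<m+1) k = toMod (coeff-≋ k)
    where
    coeff-≋ : ∀ k → coeff f k ≋ coeff (lincombFrom 1 (coeffsFrom f 1 m)) k
    coeff-≋ zero = ≋-trans f₀≋0 (≋-sym (≋-reflexive (coeff-lincombFrom-< (coeffsFrom f 1 m) (s≤s z≤n))))
    coeff-≋ (suc k) with suc k ℕ.≤? m
    ... | yes k<m = ≋-reflexive (sym (coeff-lincombFrom-coeffsFrom f m (s≤s z≤n) (s≤s k<m)))
    ... | no  k≮m = ≋-trans (coeff≋0 f<m+1 (suc k) m<k+1)
                            (≋-sym (≋-reflexive (coeff-lincombFrom-≥ (coeffsFrom f 1 m) m<k+1)))
      where
      m<k+1 : suc m ≤ suc k
      m<k+1 = ℕₚ.≰⇒> k≮m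

  V<1⇒≈[] : ∀ {f} → V< 1 f → f ≈[ p ] []
  V<1⇒≈[] (f₀≋0 , f<1) k = toMod (coeff≋0 (deg<-pred f<1 f₀≋0) k z≤n)

corollary3 : (p : ℕ) → Prime p → p ≢ 2 → (m : ℕ) → 1 ≤ m → m ≤ p ∸ 2 →
    (∀ f → InV p f → (InKer p m f ⇔ InSpan p m f))
      × (∀ f → InSpan p m f → InV p f)
corollary3 p pp _ m _ m≤p∸2 = (λ f Vf → mk⇔ (kernel⇒span f Vf) (span⇒kernel f)) , span⇒InV
  where
  open Modulo p

  InV⇒V< : ∀ {f} → InV p f → V< (suc (p ∸ 2)) f
  InV⇒V< (f₀≡0 , f<p-1) = fromMod f₀≡0 , mkDeg< λ k le → fromMod (f<p-1 k le)

  span⇒V< : ∀ f → InSpan p m f → V< (suc m) f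
  span⇒V< f (as , f≈as) = V<-resp-≈ {f = f} f≈as (V<-lincombFrom as)

  V<⇒InV : ∀ {f} → V< (suc (p ∸ 2)) f → InV p f
  V<⇒InV (f₀≋0 , f<p-1) = toMod f₀≋0 , λ k le → toMod (coeff≋0 f<p-1 k le)

  span⇒InV : ∀ f → InSpan p m f → InV p f
  span⇒InV f f∈span = V<⇒InV (V<-mono (s≤s m≤p∸2) (span⇒V< f f∈span))

  span⇒kernel : ∀ f → InSpan p m f → InKer p m f
  span⇒kernel f f∈span = V<1⇒≈[] (iter-A-I-V< m f (V<-cast (ℕₚ.+-comm 1 m) (span⇒V< f f∈span)))

  kernel⇒span : ∀ f → InV p f → InKer p m f → InSpan p m f
  kernel⇒span f Vf f∈ker = coeffsFrom f 1 m , V<⇒≈lincombFrom (kernel-V< pp m≤p∸2 p∸2<p Tᵐf≋0 (InV⇒V< Vf))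
    where
    Tᵐf≋0 : deg (iter m A-I f) < 0
    Tᵐf≋0 = mkDeg< λ k _ → fromMod (f∈ker k)
    p∸2<p : p ∸ 2 < p
    p∸2<p = ℕₚ.∸-monoʳ-< {p} {2} {0} (s≤s z≤n) (ℕ.nonTrivial⇒n>1 p {{prime⇒nonTrivial pp}})
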